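{- Let $n>2$. Then $(\mathfrak{C}(n)_\bot,\sqsubseteq)$ is a lattice, with top element $N\{N\}$ and bottom element $\bot$, in which supremum and infimum of two embedded subsets are given by $(S,\pi)\vee(S',\pi')=(T\cup T',\rho)$, where $T,T'$ are the blocks of $\pi\vee\pi'$ (join in $\Pi(n)$) containing $S$ and $S'$ respectively, and $\rho$ is the partition obtained from $\pi\vee\pi'$ by merging $T$ and $T'$ (so $\rho=\pi\vee\pi'$ if $T=T'$); $(S,\pi)\wedge(S',\pi')=(S\cap S',\pi\wedge\pi')$ if $S\cap S'\neq\emptyset$, and $(S,\pi)\wedge(S',\pi')=\bot$ otherwise. Moreover, every element is complemented: for a given $S\pi$ with $S\ne N$, any embedded subset of the form $(N\setminus S,\sigma)$, with $\sigma$ any partition of $N$ having $N\setminus S$ as a block, is a complement of $S\pi$.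
   Context: Let $N=\{1,\dots,n\}$ and $\Pi(n)$ the lattice of partitions of $N$ ordered by refinement ($\pi\le\pi'$ iff every block of $\pi$ is contained in a block of $\pi'$). An embedded subset is a pair $(S,\pi)$, also written $S\pi$, where $S\subseteq N$ is nonempty and $\pi\in\Pi(n)$ has $S$ as one of its blocks. $\mathfrak{C}(n)$ denotes the set of embedded subsets, and $\mathfrak{C}(n)_\bot=\mathfrak{C}(n)\cup\{\bot\}$ with $\bot$ an added element. The order $\sqsubseteq$ is: $\bot\sqsubseteq x$ for all $x$, and $(S,\pi)\sqsubseteq(S',\pi')$ iff $S\subseteq S'$ and $\pi\le\pi'$. $N\{N\}$ denotes $(N,\{N\})$. A complement of $x$ is an element $y$ with $x\wedge y=\bot$ and $x\vee y=N\{N\}$. -}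

module Defs where

open import Data.Bool using (Bool; true; false; _∧_; _∨_; not; if_then_else_; T)
open import Data.Nat using (ℕ; zero; suc)
open import Data.Fin using (Fin; zero; suc)
open import Data.Product using (_×_; ∃)
open import Data.Empty using (⊥)
open import Data.Unit using (⊤)
open import Relation.Binary.PropositionalEquality using (_≡_)

-- The ground set N = {1,…,n} is modelled as Fin n.
-- Subsets of N are decidable (Bool-valued) predicates.
Sub : ℕ → Set
Sub n = Fin n → Bool

-- Binary (Bool-valued) relations on N; a partition of N is represented by
-- its equivalence relation "i and j lie in the same block".
BRel : ℕ → Set
BRel n = Fin n → Fin n → Bool

IsPartition : ∀ {n} → BRel n → Set
IsPartition {n} R =
  ((i : Fin n) → T (R i i)) ×
  ((i j : Fin n) → T (R i j) → T (R j i)) ×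
  ((i j k : Fin n) → T (R i j) → T (R j k) → T (R i k))

_≤Π_ : ∀ {n} → BRel n → BRel n → Set
_≤Π_ {n} R R' = (i j : Fin n) → T (R i j) → T (R' i j)

_⊆ˢ_ : ∀ {n} → Sub n → Sub n → Set
_⊆ˢ_ {n} S S' = (i : Fin n) → T (S i) → T (S' i)

IsBlock : ∀ {n} → Sub n → BRel n → Set
IsBlock {n} S R =
  (∃ λ (i : Fin n) → T (S i)) ×
  ((i j : Fin n) → T (S i) → (T (R i j) → T (S j)) × (T (S j) → T (R i j)))

data C⊥ (n : ℕ) : Set where
  ⊥c  : C⊥ n
  emb : Sub n → BRel n → C⊥ n

-- membership in C(n)_⊥: ⊥, or an embedded subset S π
Valid : ∀ {n} → C⊥ n → Set
Valid ⊥c = ⊤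
Valid (emb S π) = IsPartition π × IsBlock S π

_⊑_ : ∀ {n} → C⊥ n → C⊥ n → Set
⊥c ⊑ y = ⊤
emb S π ⊑ ⊥c = ⊥
emb S π ⊑ emb S' π' = (S ⊆ˢ S') × (π ≤Π π')

_≈_ : ∀ {n} → C⊥ n → C⊥ n → Set
⊥c ≈ ⊥c = ⊤
⊥c ≈ emb _ _ = ⊥
emb _ _ ≈ ⊥c = ⊥
_≈_ {n} (emb S π) (emb S' π') =
  ((i : Fin n) → S i ≡ S' i) × ((i j : Fin n) → π i j ≡ π' i j)

topC : (n : ℕ) → C⊥ n
topC n = emb (λ _ → true) (λ _ _ → true)

anyFin : ∀ {n} → (Fin n → Bool) → Bool
anyFin {zero} f = false
anyFin {suc n} f = f zero ∨ anyFin (λ i → f (suc i))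

sq : ∀ {n} → BRel n → BRel n
sq R i j = anyFin (λ k → R i k ∧ R k j)

iter : ∀ {A : Set} → ℕ → (A → A) → A → A
iter zero f x = x
iter (suc m) f x = f (iter m f x)

-- join in Π(n): transitive closure of the union (n squarings suffice)
partJoin : ∀ {n} → BRel n → BRel n → BRel n
partJoin {n} π π' = iter n sq (λ i j → π i j ∨ π' i j)

partMeet : ∀ {n} → BRel n → BRel n → BRel n
partMeet π π' i j = π i j ∧ π' i j

blockOf : ∀ {n} → BRel n → Sub n → Sub n
blockOf J S j = anyFin (λ s → S s ∧ J s j)

_⊔_ : ∀ {n} → C⊥ n → C⊥ n → C⊥ n
⊥c ⊔ y = y
emb S π ⊔ ⊥c = emb S π
emb S π ⊔ emb S' π' =
  let J  = partJoin π π'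
      B  = blockOf J S
      B' = blockOf J S'
      U  = λ i → B i ∨ B' i
  in emb U (λ i j → J i j ∨ (U i ∧ U j))

_⊓_ : ∀ {n} → C⊥ n → C⊥ n → C⊥ n
⊥c ⊓ y = ⊥c
emb S π ⊓ ⊥c = ⊥c
emb S π ⊓ emb S' π' =
  if anyFin (λ i → S i ∧ S' i)
  then emb (λ i → S i ∧ S' i) (partMeet π π')
  else ⊥c

IsLub : ∀ {n} → C⊥ n → C⊥ n → C⊥ n → Set
IsLub {n} x y z = Valid z × x ⊑ z × y ⊑ z ×
  ((w : C⊥ n) → Valid w → x ⊑ w → y ⊑ w → z ⊑ w)

IsGlb : ∀ {n} → C⊥ n → C⊥ n → C⊥ n → Set
IsGlb {n} x y z = Valid z × z ⊑ x × z ⊑ y ×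
  ((w : C⊥ n) → Valid w → w ⊑ x → w ⊑ y → w ⊑ z)

IsComplement : ∀ {n} → C⊥ n → C⊥ n → Set
IsComplement {n} x y = ((x ⊓ y) ≈ ⊥c) × ((x ⊔ y) ≈ topC n)

-- The join π ∨ π' is the
-- transitive closure of π ∪ π', computed by n squarings; n suffice because a walk can be
-- shortcut until no vertex repeats, and then it has at most n vertices.
-- The supremum of S π and S' π' merges the blocks B ∋ S, B' ∋ S' of π ∨ π': any upper
-- bound W ω has π ∨ π' ≤ ω, and W, an ω-block meeting B and B', contains both.
-- A non-⊥ lower bound of S π and S' π' has a nonempty set inside S ∩ S', which is why
-- the infimum is ⊥ exactly when S ∩ S' = ∅. A complement of S π: S and N ∖ S are
-- disjoint and cover N, so the merged block is N.

module Submission where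

open import Defs
open import Data.Bool using (Bool; true; false; not; _∧_; _∨_; T)
open import Data.Bool.Properties using (∧-inverseʳ; T-≡; T-not-≡; T-∧; T-∨) renaming (_≟_ to _≟ᵇ_)
open import Data.Nat using (ℕ; suc; _≤_; _<_; s≤s)
open import Data.Nat.Properties using (m≤n⇒m≤1+n)
open import Data.Fin using (Fin; zero; suc)
open import Data.Fin.Properties using (injective⇒≤; any?) renaming (_≟_ to _≟ᶠ_)
open import Data.List using (List; []; _∷_; length; lookup)
open import Data.List.Membership.Propositional using (_∈_)
open import Data.List.Membership.Propositional.Properties using (∈-lookup)
open import Data.List.Relation.Unary.Any using (here; there) renaming (any? to anyᴸ?)
import Data.List.Relation.Unary.All as All
open import Data.List.Relation.Unary.All.Properties using (¬Any⇒All¬)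
open import Data.List.Relation.Unary.AllPairs using (_∷_; [])
open import Data.List.Relation.Unary.Unique.Propositional using (Unique)
open import Data.Product using (_×_; ∃; _,_; proj₁; proj₂)
open import Data.Sum using (_⊎_; inj₁; inj₂)
open import Data.Unit using (tt)
open import Data.Empty using (⊥-elim)
open import Relation.Nullary using (yes; no)
open import Relation.Nullary.Decidable using (⌊_⌋; toWitness; fromWitness)
open import Relation.Binary.Construct.Closure.ReflexiveTransitive using (Star; ε; _◅_; _◅◅_)
open import Function.Bundles using (module Equivalence)
open Equivalence using (to; from)
open import Relation.Binary.PropositionalEquality using (_≡_; refl; sym; trans; cong; subst)

-- T-∧ and T-∨ with the operands explicit: they cannot be inferred from T (a ∧ b).
T-∨-introˡ : ∀ a b → T a → T (a ∨ b)
T-∨-introˡ a b t = from (T-∨ {a} {b}) (inj₁ t)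

T-∨-introʳ : ∀ a b → T b → T (a ∨ b)
T-∨-introʳ a b t = from (T-∨ {a} {b}) (inj₂ t)

T-∨-elim : ∀ a b → T (a ∨ b) → T a ⊎ T b
T-∨-elim a b = to (T-∨ {a} {b})

T-∧-intro : ∀ a b → T a → T b → T (a ∧ b)
T-∧-intro a b s t = from (T-∧ {a} {b}) (s , t)

T-∧-fst : ∀ a b → T (a ∧ b) → T a
T-∧-fst a b t = proj₁ (to (T-∧ {a} {b}) t)

T-∧-snd : ∀ a b → T (a ∧ b) → T b
T-∧-snd a b t = proj₂ (to (T-∧ {a} {b}) t)

T-ext : ∀ {a b} → (T a → T b) → (T b → T a) → a ≡ b
T-ext {true}  {true}  _ _ = refl
T-ext {true}  {false} f _ = ⊥-elim (f tt)
T-ext {false} {true}  _ g = ⊥-elim (g tt)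
T-ext {false} {false} _ _ = refl

anyFin-intro : ∀ {n} (f : Fin n → Bool) k → T (f k) → T (anyFin f)
anyFin-intro f zero    t = T-∨-introˡ (f zero) _ t
anyFin-intro f (suc k) t = T-∨-introʳ (f zero) _ (anyFin-intro (λ i → f (suc i)) k t)

anyFin-elim : ∀ {n} (f : Fin n → Bool) → T (anyFin f) → ∃ λ k → T (f k)
anyFin-elim {suc n} f t with T-∨-elim (f zero) _ t
... | inj₁ t₀ = zero , t₀
... | inj₂ t' with anyFin-elim (λ i → f (suc i)) t'
...   | k , tₖ = suc k , tₖ

anyFin-false : ∀ {n} (f : Fin n → Bool) → (∀ k → f k ≡ false) → anyFin f ≡ false
anyFin-false {0}      f _ = refl
anyFin-false {suc n}  f h rewrite h zero = anyFin-false (λ i → f (suc i)) (λ k → h (suc k))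

Unique-lookup-injective : ∀ {A : Set} {xs : List A} → Unique xs →
                          ∀ {a b} → lookup xs a ≡ lookup xs b → a ≡ b
Unique-lookup-injective (_ ∷ _) {zero}  {zero}  _ = refl
Unique-lookup-injective (x∉ ∷ _) {zero}  {suc b} e = ⊥-elim (All.lookup x∉ (∈-lookup b) e)
Unique-lookup-injective (x∉ ∷ _) {suc a} {zero}  e = ⊥-elim (All.lookup x∉ (∈-lookup a) (sym e))
Unique-lookup-injective (_ ∷ u)  {suc a} {suc b} e = cong suc (Unique-lookup-injective u e)

Unique-length≤ : ∀ {n} {xs : List (Fin n)} → Unique xs → length xs ≤ n
Unique-length≤ u = injective⇒≤ (Unique-lookup-injective u)

Reflexiveᵇ Symmetricᵇ Transitiveᵇ : ∀ {n} → BRel n → Set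
Reflexiveᵇ  {n} R = (i : Fin n) → T (R i i)
Symmetricᵇ  {n} R = (i j : Fin n) → T (R i j) → T (R j i)
Transitiveᵇ {n} R = (i j k : Fin n) → T (R i j) → T (R j k) → T (R i k)

iter-sq-sym : ∀ {n} {R : BRel n} → Symmetricᵇ R → ∀ m → Symmetricᵇ (iter m sq R)
iter-sq-sym R-sym 0       i j r = R-sym i j r
iter-sq-sym {R = R} R-sym (suc m) i j t with anyFin-elim (λ k → iter m sq R i k ∧ iter m sq R k j) t
... | k , p = anyFin-intro _ k (T-∧-intro _ _ (iter-sq-sym R-sym m k j (T-∧-snd (iter m sq R i k) _ p))
                                              (iter-sq-sym R-sym m i k (T-∧-fst _ _ p)))

iter-sq-least : ∀ {n} {R ω : BRel n} → Transitiveᵇ ω → R ≤Π ω → ∀ m → iter m sq R ≤Π ω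
iter-sq-least ω-trans R≤ω 0       = R≤ω
iter-sq-least {R = R} ω-trans R≤ω (suc m) i j t with anyFin-elim (λ k → iter m sq R i k ∧ iter m sq R k j) t
... | k , p = ω-trans i k j (iter-sq-least ω-trans R≤ω m i k (T-∧-fst _ _ p))
                            (iter-sq-least ω-trans R≤ω m k j (T-∧-snd (iter m sq R i k) _ p))

module SquaringClosure {n : ℕ} (R : BRel n) (R-refl : Reflexiveᵇ R) where

  Walk : Fin n → Fin n → Set
  Walk = Star (λ i j → T (R i j))

  vertices : ∀ {i j} → Walk i j → List (Fin n)
  vertices {i} ε       = i ∷ []
  vertices {i} (_ ◅ w) = i ∷ vertices w

  walk-from : ∀ {i k j} (w : Walk k j) → i ∈ vertices w →
              ∃ λ (v : Walk i j) → Unique (vertices w) → Unique (vertices v)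
  walk-from ε       (here refl) = ε , λ u → u
  walk-from (r ◅ w) (here refl) = r ◅ w , λ u → u
  walk-from (_ ◅ w) (there p) with walk-from w p
  ... | v , uv = v , λ { (_ ∷ u) → uv u }

  shortcut : ∀ {i j} → Walk i j → ∃ λ (v : Walk i j) → Unique (vertices v)
  shortcut ε = ε , (All.[] ∷ [])
  shortcut {i} (r ◅ w) with shortcut w
  ... | w' , u with anyᴸ? (i ≟ᶠ_) (vertices w')
  ...   | yes i∈w' = let v , uv = walk-from w' i∈w' in v , uv u
  ...   | no  i∉w' = r ◅ w' , (¬Any⇒All¬ _ i∉w' ∷ u)

  R^ : ℕ → BRel n
  R^ m = iter m sq R

  R^-refl : ∀ m i → T (R^ m i i)
  R^-refl 0       i = R-refl i
  R^-refl (suc m) i = anyFin-intro _ i (T-∧-intro _ _ (R^-refl m i) (R^-refl m i))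

  R⊆R^ : ∀ m → R ≤Π R^ m
  R⊆R^ 0       i j r = r
  R⊆R^ (suc m) i j r = anyFin-intro _ i (T-∧-intro _ _ (R^-refl m i) (R⊆R^ m i j r))

  walk⇒R^ : ∀ m {i j} (w : Walk i j) → length (vertices w) ≤ suc m → T (R^ m i j)
  walk⇒R^ m       {i} ε                 _       = R^-refl m i
  walk⇒R^ 0           (_ ◅ ε)           (s≤s ())
  walk⇒R^ 0           (_ ◅ _ ◅ _)       (s≤s ())
  walk⇒R^ (suc m) {i} (_◅_ {j = k} r w) (s≤s ℓ) =
    anyFin-intro _ k (T-∧-intro _ _ (R⊆R^ m i k r) (walk⇒R^ m w ℓ))

  R^⇒walk : ∀ m {i j} → T (R^ m i j) → Walk i j
  R^⇒walk 0       r = r ◅ ε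
  R^⇒walk (suc m) {i} {j} t with anyFin-elim (λ k → R^ m i k ∧ R^ m k j) t
  ... | k , p = R^⇒walk m (T-∧-fst (R^ m i k) _ p) ◅◅ R^⇒walk m (T-∧-snd (R^ m i k) _ p)

  R^n-trans : Transitiveᵇ (R^ n)
  R^n-trans i k j p q with shortcut (R^⇒walk n p ◅◅ R^⇒walk n q)
  ... | v , u = walk⇒R^ n v (m≤n⇒m≤1+n (Unique-length≤ u))

module _ {n} {π π' : BRel n} (π-part : IsPartition π) (π'-part : IsPartition π') where

  private
    R₀ : BRel n
    R₀ i j = π i j ∨ π' i j

    R₀-refl : Reflexiveᵇ R₀
    R₀-refl i = T-∨-introˡ (π i i) _ (proj₁ π-part i)

    R₀-sym : Symmetricᵇ R₀
    R₀-sym i j r with T-∨-elim (π i j) _ r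
    ... | inj₁ p  = T-∨-introˡ (π j i) _ (proj₁ (proj₂ π-part) i j p)
    ... | inj₂ p' = T-∨-introʳ (π j i) _ (proj₁ (proj₂ π'-part) i j p')

    open SquaringClosure R₀ R₀-refl

  partJoin-isPartition : IsPartition (partJoin π π')
  partJoin-isPartition = R^-refl n , iter-sq-sym R₀-sym n , R^n-trans

  partJoin-upperˡ : π ≤Π partJoin π π'
  partJoin-upperˡ i j p = R⊆R^ n i j (T-∨-introˡ (π i j) _ p)

  partJoin-upperʳ : π' ≤Π partJoin π π'
  partJoin-upperʳ i j p = R⊆R^ n i j (T-∨-introʳ (π i j) _ p)

  partJoin-least : ∀ {ω} → Transitiveᵇ ω → π ≤Π ω → π' ≤Π ω → partJoin π π' ≤Π ω
  partJoin-least {ω} ω-trans π≤ω π'≤ω = iter-sq-least ω-trans R₀≤ω n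
    where
    R₀≤ω : R₀ ≤Π ω
    R₀≤ω i j r with T-∨-elim (π i j) _ r
    ... | inj₁ p  = π≤ω i j p
    ... | inj₂ p' = π'≤ω i j p'

Closed : ∀ {n} → BRel n → Sub n → Set
Closed {n} J U = (i j : Fin n) → T (U i) → T (J i j) → T (U j)

_∪ˢ_ : ∀ {n} → Sub n → Sub n → Sub n
(U ∪ˢ V) i = U i ∨ V i

_∩ˢ_ : ∀ {n} → Sub n → Sub n → Sub n
(U ∩ˢ V) i = U i ∧ V i

∪ˢ-closed : ∀ {n} {J : BRel n} {U V} → Closed J U → Closed J V → Closed J (U ∪ˢ V)
∪ˢ-closed {U = U} U-closed V-closed i j u∪v r with T-∨-elim (U i) _ u∪v
... | inj₁ u = T-∨-introˡ (U j) _ (U-closed i j u r)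
... | inj₂ v = T-∨-introʳ (U j) _ (V-closed i j v r)

⊆-blockOf : ∀ {n} {J : BRel n} → Reflexiveᵇ J → ∀ S → S ⊆ˢ blockOf J S
⊆-blockOf J-refl S i s = anyFin-intro _ i (T-∧-intro (S i) _ s (J-refl i))

blockOf-closed : ∀ {n} {J : BRel n} → Transitiveᵇ J → ∀ S → Closed J (blockOf J S)
blockOf-closed {J = J} J-trans S i j b r with anyFin-elim (λ s → S s ∧ J s i) b
... | s , p = anyFin-intro _ s (T-∧-intro (S s) _ (T-∧-fst (S s) _ p)
                                                  (J-trans s i j (T-∧-snd (S s) _ p) r))

blockOf-least : ∀ {n} {J ω : BRel n} {S W} → IsBlock W ω → J ≤Π ω → S ⊆ˢ W → blockOf J S ⊆ˢ W
blockOf-least {J = J} {S = S} (_ , W-block) J≤ω S⊆W j b with anyFin-elim (λ s → S s ∧ J s j) b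
... | s , p = proj₁ (W-block s j (S⊆W s (T-∧-fst (S s) _ p))) (J≤ω s j (T-∧-snd (S s) _ p))

merge : ∀ {n} → BRel n → Sub n → BRel n
merge J U i j = J i j ∨ (U i ∧ U j)

module _ {n} {J : BRel n} {U : Sub n} (J-part : IsPartition J) (U-closed : Closed J U) where

  private
    UU⊆merge : ∀ i j → T (U i) → T (U j) → T (merge J U i j)
    UU⊆merge i j u u' = T-∨-introʳ (J i j) _ (T-∧-intro (U i) _ u u')

  merge-isPartition : IsPartition (merge J U)
  merge-isPartition = m-refl , m-sym , m-trans
    where
    m-refl : Reflexiveᵇ (merge J U)
    m-refl i = T-∨-introˡ (J i i) _ (proj₁ J-part i)
    m-sym : Symmetricᵇ (merge J U)
    m-sym i j m with T-∨-elim (J i j) _ m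
    ... | inj₁ r  = T-∨-introˡ (J j i) _ (proj₁ (proj₂ J-part) i j r)
    ... | inj₂ uu = UU⊆merge j i (T-∧-snd (U i) _ uu) (T-∧-fst (U i) _ uu)
    m-trans : Transitiveᵇ (merge J U)
    m-trans i j k m m' with T-∨-elim (J i j) _ m | T-∨-elim (J j k) _ m'
    ... | inj₁ r  | inj₁ r'  = T-∨-introˡ (J i k) _ (proj₂ (proj₂ J-part) i j k r r')
    ... | inj₁ r  | inj₂ uu' = UU⊆merge i k (U-closed j i (T-∧-fst (U j) _ uu') (proj₁ (proj₂ J-part) i j r))
                                            (T-∧-snd (U j) _ uu')
    ... | inj₂ uu | inj₁ r'  = UU⊆merge i k (T-∧-fst (U i) _ uu) (U-closed j k (T-∧-snd (U i) _ uu) r')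
    ... | inj₂ uu | inj₂ uu' = UU⊆merge i k (T-∧-fst (U i) _ uu) (T-∧-snd (U j) _ uu')

  merge-isBlock : (∃ λ i → T (U i)) → IsBlock U (merge J U)
  merge-isBlock U-nonempty = U-nonempty , λ i j u → merge⇒U i j u , UU⊆merge i j u
    where
    merge⇒U : ∀ i j → T (U i) → T (merge J U i j) → T (U j)
    merge⇒U i j u m with T-∨-elim (J i j) _ m
    ... | inj₁ r  = U-closed i j u r
    ... | inj₂ uu = T-∧-snd (U i) _ uu

merge-least : ∀ {n} {J ω : BRel n} {U W} → IsBlock W ω → J ≤Π ω → U ⊆ˢ W → merge J U ≤Π ω
merge-least {J = J} {U = U} (_ , W-block) J≤ω U⊆W i j m with T-∨-elim (J i j) _ m
... | inj₁ r  = J≤ω i j r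
... | inj₂ uu = proj₂ (W-block i j (U⊆W i (T-∧-fst (U i) _ uu))) (U⊆W j (T-∧-snd (U i) _ uu))

⊑-refl : ∀ {n} (x : C⊥ n) → x ⊑ x
⊑-refl ⊥c        = tt
⊑-refl (emb S π) = (λ _ s → s) , (λ _ _ p → p)

⊑-trans : ∀ {n} (x y z : C⊥ n) → x ⊑ y → y ⊑ z → x ⊑ z
⊑-trans ⊥c        _          _            _         _         = tt
⊑-trans (emb _ _) (emb _ _) (emb _ _) (S⊆ , π≤) (S'⊆ , π'≤) =
  (λ i s → S'⊆ i (S⊆ i s)) , (λ i j p → π'≤ i j (π≤ i j p))

⊑-antisym : ∀ {n} (x y : C⊥ n) → x ⊑ y → y ⊑ x → x ≈ y
⊑-antisym ⊥c        ⊥c        _         _         = tt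
⊑-antisym (emb _ _) (emb _ _) (S⊆ , π≤) (S⊇ , π≥) =
  (λ i → T-ext (S⊆ i) (S⊇ i)) , (λ i j → T-ext (π≤ i j) (π≥ i j))

topC-valid : ∀ {n} → Fin n → Valid (topC n)
topC-valid i =
  ((λ _ → tt) , (λ _ _ _ → tt) , (λ _ _ _ _ _ → tt)) ,
  (i , tt) , λ _ _ _ → (λ _ → tt) , (λ _ → tt)

⊑-topC : ∀ {n} (x : C⊥ n) → x ⊑ topC n
⊑-topC ⊥c        = tt
⊑-topC (emb _ _) = (λ _ _ → tt) , (λ _ _ _ → tt)

⊔-isLub : ∀ {n} (x y : C⊥ n) → Valid x → Valid y → IsLub x y (x ⊔ y)
⊔-isLub ⊥c y _ y-valid = y-valid , tt , ⊑-refl y , λ _ _ _ y⊑w → y⊑w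
⊔-isLub (emb S π) ⊥c x-valid _ = x-valid , ⊑-refl _ , tt , λ _ _ x⊑w _ → x⊑w
⊔-isLub {n} (emb S π) (emb S' π') (π-part , (s , s∈S) , _) (π'-part , _) =
  (merge-isPartition J-part U-closed , merge-isBlock J-part U-closed (s , S⊆U s s∈S)) ,
  (S⊆U , λ i j p → T-∨-introˡ (J i j) _ (partJoin-upperˡ π-part π'-part i j p)) ,
  (S'⊆U , λ i j p → T-∨-introˡ (J i j) _ (partJoin-upperʳ π-part π'-part i j p)) ,
  least
  where
  J = partJoin π π'
  J-part = partJoin-isPartition π-part π'-part
  J-trans = proj₂ (proj₂ J-part)
  U = blockOf J S ∪ˢ blockOf J S'
  U-closed : Closed J U
  U-closed = ∪ˢ-closed (blockOf-closed J-trans S) (blockOf-closed J-trans S')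
  S⊆U : S ⊆ˢ U
  S⊆U i s = T-∨-introˡ (blockOf J S i) _ (⊆-blockOf (proj₁ J-part) S i s)
  S'⊆U : S' ⊆ˢ U
  S'⊆U i s = T-∨-introʳ (blockOf J S i) _ (⊆-blockOf (proj₁ J-part) S' i s)
  least : (w : C⊥ n) → Valid w → emb S π ⊑ w → emb S' π' ⊑ w → emb U (merge J U) ⊑ w
  least (emb W ω) ((_ , _ , ω-trans) , W-block) (S⊆W , π≤ω) (S'⊆W , π'≤ω) =
    U⊆W , merge-least W-block J≤ω U⊆W
    where
    J≤ω = partJoin-least π-part π'-part ω-trans π≤ω π'≤ω
    U⊆W : U ⊆ˢ W
    U⊆W i u with T-∨-elim (blockOf J S i) _ u
    ... | inj₁ b  = blockOf-least W-block J≤ω S⊆W i b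
    ... | inj₂ b' = blockOf-least W-block J≤ω S'⊆W i b'

partMeet-isPartition : ∀ {n} {π π' : BRel n} → IsPartition π → IsPartition π' →
                       IsPartition (partMeet π π')
partMeet-isPartition {π = π} (p-refl , p-sym , p-trans) (p'-refl , p'-sym , p'-trans) =
  (λ i → T-∧-intro (π i i) _ (p-refl i) (p'-refl i)) ,
  (λ i j m → T-∧-intro (π j i) _ (p-sym i j (T-∧-fst (π i j) _ m)) (p'-sym i j (T-∧-snd (π i j) _ m))) ,
  (λ i j k m m' → T-∧-intro (π i k) _ (p-trans i j k (T-∧-fst (π i j) _ m) (T-∧-fst (π j k) _ m'))
                                      (p'-trans i j k (T-∧-snd (π i j) _ m) (T-∧-snd (π j k) _ m')))

∩ˢ-isBlock : ∀ {n} {S S' : Sub n} {π π'} → IsBlock S π → IsBlock S' π' →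
             (∃ λ i → T ((S ∩ˢ S') i)) → IsBlock (S ∩ˢ S') (partMeet π π')
∩ˢ-isBlock {S = S} {π = π} (_ , S-block) (_ , S'-block) nonempty = nonempty , λ i j s∩s' →
  let s = T-∧-fst (S i) _ s∩s' ; s' = T-∧-snd (S i) _ s∩s' in
  (λ m → T-∧-intro (S j) _ (proj₁ (S-block i j s) (T-∧-fst (π i j) _ m))
                           (proj₁ (S'-block i j s') (T-∧-snd (π i j) _ m))) ,
  (λ t → T-∧-intro (π i j) _ (proj₂ (S-block i j s) (T-∧-fst (S j) _ t))
                             (proj₂ (S'-block i j s') (T-∧-snd (S j) _ t)))

⊓-isGlb : ∀ {n} (x y : C⊥ n) → Valid x → Valid y → IsGlb x y (x ⊓ y)
⊓-isGlb ⊥c        _  _ _ = tt , tt , tt , λ { ⊥c _ _ _ → tt }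
⊓-isGlb (emb _ _) ⊥c _ _ = tt , tt , tt , λ { ⊥c _ _ _ → tt }
⊓-isGlb {n} (emb S π) (emb S' π') (π-part , S-block) (π'-part , S'-block) with anyFin (S ∩ˢ S') in meets
... | true =
  (partMeet-isPartition π-part π'-part , ∩ˢ-isBlock S-block S'-block (anyFin-elim _ (subst T (sym meets) tt))) ,
  ((λ i s → T-∧-fst (S i) _ s) , (λ i j m → T-∧-fst (π i j) _ m)) ,
  ((λ i s → T-∧-snd (S i) _ s) , (λ i j m → T-∧-snd (π i j) _ m)) ,
  λ { ⊥c _ _ _ → tt
    ; (emb W ω) _ (W⊆S , ω≤π) (W⊆S' , ω≤π') →
        (λ i w → T-∧-intro (S i) _ (W⊆S i w) (W⊆S' i w)) ,
        (λ i j o → T-∧-intro (π i j) _ (ω≤π i j o) (ω≤π' i j o)) }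
... | false = tt , tt , tt ,
  λ { ⊥c _ _ _ → tt
    ; (emb W ω) (_ , (i , w) , _) (W⊆S , _) (W⊆S' , _) →
        subst T meets (anyFin-intro (S ∩ˢ S') i (T-∧-intro (S i) _ (W⊆S i w) (W⊆S' i w))) }

∁ : ∀ {n} → Sub n → Sub n
∁ S i = not (S i)

⊓-∁-disjoint : ∀ {n} (S : Sub n) π σ → (emb S π ⊓ emb (∁ S) σ) ≈ ⊥c
⊓-∁-disjoint S π σ rewrite anyFin-false (S ∩ˢ ∁ S) (λ i → ∧-inverseʳ (S i)) = tt

⊔-∁-covers : ∀ {n} {S : Sub n} {π σ} → IsPartition π → IsPartition σ →
             (emb S π ⊔ emb (∁ S) σ) ≈ topC n
⊔-∁-covers {n} {S} {π} {σ} π-part σ-part =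
  (λ i → to T-≡ (U-full i)) ,
  (λ i j → to T-≡ (T-∨-introʳ (J i j) _ (T-∧-intro (U i) _ (U-full i) (U-full j))))
  where
  J = partJoin π σ
  J-refl = proj₁ (partJoin-isPartition π-part σ-part)
  U = blockOf J S ∪ˢ blockOf J (∁ S)
  U-full : ∀ i → T (U i)
  U-full i with S i in e
  ... | true  = T-∨-introˡ (blockOf J S i) _ (⊆-blockOf J-refl S i (subst T (sym e) tt))
  ... | false = T-∨-introʳ (blockOf J S i) _ (⊆-blockOf J-refl (∁ S) i (subst (λ b → T (not b)) (sym e) tt))

∁-isComplement : ∀ {n} (S : Sub n) {π σ} → IsPartition π → IsPartition σ →
                 IsComplement (emb S π) (emb (∁ S) σ)
∁-isComplement S {π} {σ} π-part σ-part = ⊓-∁-disjoint S π σ , ⊔-∁-covers π-part σ-part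

sameSide : ∀ {n} → Sub n → BRel n
sameSide S i j = ⌊ S i ≟ᵇ S j ⌋

sameSide-isPartition : ∀ {n} (S : Sub n) → IsPartition (sameSide S)
sameSide-isPartition S =
  (λ i → fromWitness refl) ,
  (λ i j e → fromWitness (sym (toWitness e))) ,
  (λ i j k e e' → fromWitness (trans (toWitness e) (toWitness e')))

∁-isBlock : ∀ {n} (S : Sub n) → (∃ λ i → T (∁ S i)) → IsBlock (∁ S) (sameSide S)
∁-isBlock S nonempty = nonempty , λ i j i∉S →
  (λ e → subst (λ b → T (not b)) (toWitness e) i∉S) ,
  (λ j∉S → fromWitness (trans (to (T-not-≡ {S i}) i∉S) (sym (to (T-not-≡ {S j}) j∉S))))

complemented : ∀ {n} → Fin n → (x : C⊥ n) → Valid x → ∃ λ y → Valid y × IsComplement x y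
complemented {n} i₀ ⊥c _ = topC n , topC-valid i₀ , tt , (λ _ → refl) , (λ _ _ → refl)
complemented i₀ (emb S π) (π-part , S-block) with any? (λ i → S i ≟ᵇ false)
... | yes (i , i∉S) =
  emb (∁ S) (sameSide S) ,
  (sameSide-isPartition S , ∁-isBlock S (i , from (T-not-≡ {S i}) i∉S)) ,
  ∁-isComplement S π-part (sameSide-isPartition S)
... | no S-full =
  ⊥c , tt , tt ,
  (λ i → to T-≡ (S-all i)) ,
  (λ i j → to T-≡ (proj₂ (proj₂ S-block i j (S-all i)) (S-all j)))
  where
  S-all : ∀ i → T (S i)
  S-all i with S i in e
  ... | true  = tt
  ... | false = S-full (i , e)

proposition2 : (n : ℕ) → 2 < n →
    ((x : C⊥ n) → Valid x → x ⊑ x) ×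
    ((x y z : C⊥ n) → Valid x → Valid y → Valid z → x ⊑ y → y ⊑ z → x ⊑ z) ×
    ((x y : C⊥ n) → Valid x → Valid y → x ⊑ y → y ⊑ x → x ≈ y) ×
    Valid (topC n) × ((x : C⊥ n) → Valid x → x ⊑ topC n) ×
    ((x : C⊥ n) → ⊥c ⊑ x) ×
    ((x y : C⊥ n) → Valid x → Valid y → IsLub x y (x ⊔ y)) ×
    ((x y : C⊥ n) → Valid x → Valid y → IsGlb x y (x ⊓ y)) ×
    ((x : C⊥ n) → Valid x → ∃ λ y → Valid y × IsComplement x y) ×
    ((S : Fin n → Bool) (π σ : Fin n → Fin n → Bool) →
    Valid (emb S π) → (∃ λ i → S i ≡ false) →
    Valid (emb (λ i → not (S i)) σ) →
    IsComplement (emb S π) (emb (λ i → not (S i)) σ))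
proposition2 (suc _) _ =
  (λ x _ → ⊑-refl x) ,
  (λ x y z _ _ _ → ⊑-trans x y z) ,
  (λ x y _ _ → ⊑-antisym x y) ,
  topC-valid zero ,
  (λ x _ → ⊑-topC x) ,
  (λ _ → tt) ,
  ⊔-isLub ,
  ⊓-isGlb ,
  complemented zero ,
  λ S _ _ (π-part , _) _ (σ-part , _) → ∁-isComplement S π-part σ-part
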